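{- Let $A=(a_1,\ldots,a_k)$ be positive integers with sum $n$ and $S\subseteq\{1,\ldots,k\}$. There is a bijection between the set of $(A,S)$-permutations of $\{1,\ldots,n\}$ and the set of $A$-good ornaments.
   Context: Blocks: $A_i=\{a_1+\cdots+a_{i-1}+1,\ldots,a_1+\cdots+a_i\}$. An $(A,S)$-permutation is a permutation of $\{1,\ldots,n\}$ that is decreasing on each block $A_i$ with $i\in S$ and increasing on each block $A_i$ with $i\notin S$. A necklace is a sequence of colors from $\{1,\ldots,k\}$ taken up to cyclic rotation; an ornament is a finite multiset of necklaces; it is $A$-compatible if exactly $a_i$ of its vertices have color $i$ for each $i$. A necklace is $1$-repeating if it is not the concatenation of $r\ge2$ copies of a shorter sequence. An $A$-good ornament is an $A$-compatible ornament in which every necklace is $1$-repeating. -}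

module Defs where

open import Data.Nat using (ℕ; zero; suc; _+_; _≤_; _<_)
open import Data.Fin using (Fin; toℕ) renaming (zero to fz; suc to fs)
open import Data.Fin.Subset using (Subset; _∈_; _∉_)
open import Data.List using (List; []; _∷_; _++_; concat; replicate; length)
open import Data.List.Relation.Unary.All using (All)
open import Data.Product using (Σ; ∃; ∃-syntax; _×_; proj₁)
open import Relation.Nullary using (¬_)
open import Relation.Binary using (Rel; Setoid)
open import Relation.Binary.PropositionalEquality using (_≡_; _→-setoid_)
import Relation.Binary.PropositionalEquality as P
open import Function.Definitions using (Injective)
import Relation.Binary.Construct.On as On
import Relation.Binary.Construct.Closure.Equivalence as EqC
import Data.List.Relation.Binary.Permutation.Setoid as PermS
import Data.Fin as F

-- A composition A = (a_1,…,a_k) is a function Fin k → ℕ (0-indexed blocks).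

total : ∀ {k} → (Fin k → ℕ) → ℕ
total {zero}  A = 0
total {suc k} A = A fz + total (λ i → A (fs i))

start : ∀ {k} → (Fin k → ℕ) → Fin k → ℕ
start A fz     = 0
start A (fs i) = A fz + start (λ j → A (fs j)) i

-- position p (0-indexed, i.e. p+1 ∈ {1..n}) lies in block A_i
InBlock : ∀ {k n} → (Fin k → ℕ) → Fin k → Fin n → Set
InBlock A i p = start A i ≤ toℕ p × toℕ p < start A i + A i

-- a permutation of {1,…,n} (0-indexed as Fin n): an injective map Fin n → Fin n
-- (injective self-maps of a finite set are exactly the bijections)
IsPerm : ∀ {n} → (Fin n → Fin n) → Set
IsPerm σ = Injective _≡_ _≡_ σ

IsASPerm : ∀ {k} (A : Fin k → ℕ) (S : Subset k) → (Fin (total A) → Fin (total A)) → Set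
IsASPerm {k} A S σ =
  IsPerm σ ×
  (∀ (i : Fin k) (p q : Fin (total A)) → InBlock A i p → InBlock A i q → p F.< q →
     (i ∈ S → σ q F.< σ p) × (i ∉ S → σ p F.< σ q))

ASPermSetoid : ∀ {k} (A : Fin k → ℕ) (S : Subset k) → Setoid _ _
ASPermSetoid A S =
  On.setoid (Fin (total A) →-setoid Fin (total A))
            (proj₁ {B = IsASPerm A S})

-- Words (sequences of colours in {1..k}, 0-indexed as Fin k)
Word : ℕ → Set
Word k = List (Fin k)

Rot : ∀ {k} → Rel (Word k) _
Rot xs ys = ∃[ u ] ∃[ v ] (xs ≡ u ++ v × ys ≡ v ++ u)

-- necklaces: words up to cyclic rotation (equivalence closure of Rot,
-- which coincides with Rot itself)
NecklaceSetoid : ℕ → Setoid _ _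
NecklaceSetoid k = EqC.setoid (Rot {k})

-- ornaments: finite multisets of necklaces = lists of words up to
-- reordering and rotating individual words
OrnamentSetoid : ℕ → Setoid _ _
OrnamentSetoid k = PermS.↭-setoid (NecklaceSetoid k)

Ornament : ℕ → Set
Ornament k = List (Word k)

countW : ∀ {k} → Fin k → Word k → ℕ
countW c []       = 0
countW c (x ∷ xs) with F._≟_ c x
... | Relation.Nullary.yes _ = suc (countW c xs)
... | Relation.Nullary.no  _ = countW c xs

countO : ∀ {k} → Fin k → Ornament k → ℕ
countO c []       = 0
countO c (w ∷ ws) = countW c w + countO c ws

Compatible : ∀ {k} → (Fin k → ℕ) → Ornament k → Set
Compatible A O = ∀ i → countO i O ≡ A i

OneRepeating : ∀ {k} → Word k → Set
OneRepeating w = ¬ (∃[ r ] ∃[ u ] (2 ≤ r × length u < length w × w ≡ concat (replicate r u)))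

NonEmpty : ∀ {k} → Word k → Set
NonEmpty w = 1 ≤ length w

IsGood : ∀ {k} → (Fin k → ℕ) → Ornament k → Set
IsGood A O = Compatible A O × All (λ w → NonEmpty w × OneRepeating w) O

GoodOrnamentSetoid : ∀ {k} (A : Fin k → ℕ) → Setoid _ _
GoodOrnamentSetoid {k} A = On.setoid (OrnamentSetoid k) (proj₁ {B = IsGood A})

-- Reading an (A,S)-permutation σ backwards, position j receives the colour of
-- the block containing σ⁻¹ j.  This is a word with content A, and σ can be
-- recovered from it because σ is monotone on each block: the element of block c
-- of rank r (counted from the right when c ∈ S) goes to the r-th occurrence of c.
-- Words correspond to A-good ornaments by the Chen–Fox–Lyndon theorem: every word
-- is uniquely a nonincreasing concatenation of Lyndon words, and the Lyndon words
-- are exactly the least rotations of the 1-repeating necklaces.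

module Submission where

open import Defs
open import Data.Nat using (ℕ; _≤_)
open import Data.Fin using (Fin)
open import Data.Fin.Subset using (Subset)
open import Function.Bundles using (Bijection)

import Algebra.Construct.NaturalChoice.Min as NaturalChoiceMin
open import Data.Empty using (⊥; ⊥-elim)
open import Data.Fin as F using (toℕ) renaming (zero to fz; suc to fs)
import Data.Fin.Properties as FP
open import Data.Fin.Subset using (_∈_; _∉_)
open import Data.Fin.Subset.Properties using (_∈?_)
open import Data.List as L using (List; []; _∷_; _++_; length)
import Data.List.Properties as LP
open import Data.List.Relation.Binary.Pointwise using (Pointwise; []; _∷_; Pointwise-≡⇒≡)
import Data.List.Relation.Binary.Permutation.Propositional as PermP
open import Data.List.Relation.Binary.Permutation.Propositional using (↭⇒↭ₛ; ↭⇒↭ₛ′)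
import Data.List.Relation.Binary.Permutation.Propositional.Properties as PermPP
import Data.List.Relation.Binary.Permutation.Setoid as PermS
import Data.List.Relation.Binary.Permutation.Setoid.Properties as PermSP
open import Data.List.Relation.Unary.All as All using (All; []; _∷_)
open import Data.List.Relation.Unary.Linked as Linked using (Linked; []; [-]; _∷_)
import Data.List.Relation.Unary.Sorted.TotalOrder.Properties as SortedP
import Data.List.Sort as Sort
open import Data.Maybe using (Maybe; just; nothing)
import Data.Maybe.Properties as MaybeP
open import Data.Nat as ℕ using (zero; suc; _+_; _∸_; z≤n; s≤s)
import Data.Nat.Properties as ℕP
import Algebra.Properties.CommutativeSemigroup ℕP.+-commutativeSemigroup as ℕCS
open import Data.Product using (Σ; ∃; _×_; _,_; proj₁; proj₂)
open import Data.Sum using (_⊎_; inj₁; inj₂)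
open import Function.Base using (_∘_)
open import Function.Bundles using (Inverse)
import Function.Construct.Composition as Composition
open import Function.Definitions using (Injective; Congruent; StrictlyInverseˡ; StrictlyInverseʳ)
open import Function.Properties.Inverse using (Inverse⇒Bijection)
open import Relation.Binary.Bundles using (DecTotalOrder; Setoid)
import Relation.Binary.Construct.Closure.Equivalence as EqClosure
open import Relation.Binary.Construct.Closure.ReflexiveTransitive using (ε; _◅_)
open import Relation.Binary.Construct.Closure.Symmetric using (fwd)
import Relation.Binary.Construct.On as On
import Relation.Binary.Construct.StrictToNonStrict as StrictToNonStrict
open import Relation.Binary.Definitions using (Trichotomous; tri<; tri≈; tri>)
open import Relation.Binary.PropositionalEquality as P
  using (_≡_; _≢_; refl; sym; trans; cong; cong₂; subst; subst₂)
open import Relation.Binary.Structures using (IsStrictTotalOrder)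
open import Relation.Nullary using (¬_; Dec; yes; no)

module _ {A : Set} where

  levi : ∀ (a b c d : List A) → a ++ b ≡ c ++ d →
    (∃ λ e → c ≡ a ++ e × b ≡ e ++ d) ⊎ (∃ λ e → a ≡ c ++ e × d ≡ e ++ b)
  levi [] b c d eq = inj₁ (c , refl , eq)
  levi (x ∷ a) b [] d eq = inj₂ (x ∷ a , refl , sym eq)
  levi (x ∷ a) b (y ∷ c) d eq with LP.∷-injective eq
  ... | refl , eq′ with levi a b c d eq′
  ...   | inj₁ (e , c≡a++e , b≡e++d) = inj₁ (e , cong (x ∷_) c≡a++e , b≡e++d)
  ...   | inj₂ (e , a≡c++e , d≡e++b) = inj₂ (e , cong (x ∷_) a≡c++e , d≡e++b)

  ≢[]⇒length≥1 : ∀ {a : List A} → a ≢ [] → 1 ≤ length a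
  ≢[]⇒length≥1 {[]} a≢[] = ⊥-elim (a≢[] refl)
  ≢[]⇒length≥1 {_ ∷ _} _ = s≤s z≤n

  length<length-++ˡ : ∀ a {b : List A} → a ≢ [] → length b ℕ.< length (a ++ b)
  length<length-++ˡ a {b} a≢[] =
    subst (length b ℕ.<_) (sym (LP.length-++ a)) (ℕP.m<n+m (length b) (≢[]⇒length≥1 a≢[]))

  length<length-++ʳ : ∀ a {b : List A} → b ≢ [] → length a ℕ.< length (a ++ b)
  length<length-++ʳ a {b} b≢[] =
    subst (length a ℕ.<_) (sym (LP.length-++ a)) (ℕP.m<m+n (length a) (≢[]⇒length≥1 b≢[]))

-- Lexicographic order

module _ {k : ℕ} where

  infix 4 _<ₗ_ _≤ₗ_

  data _<ₗ_ : Word k → Word k → Set where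
    []<∷ : ∀ {y ys} → [] <ₗ y ∷ ys
    head< : ∀ {x y xs ys} → x F.< y → x ∷ xs <ₗ y ∷ ys
    tail< : ∀ {x xs ys} → xs <ₗ ys → x ∷ xs <ₗ x ∷ ys

  _≤ₗ_ : Word k → Word k → Set
  _≤ₗ_ = StrictToNonStrict._≤_ _≡_ _<ₗ_

  <ₗ-irrefl : ∀ {xs} → ¬ xs <ₗ xs
  <ₗ-irrefl (head< x<x) = FP.<-irrefl refl x<x
  <ₗ-irrefl (tail< p) = <ₗ-irrefl p

  <ₗ-trans : ∀ {xs ys zs} → xs <ₗ ys → ys <ₗ zs → xs <ₗ zs
  <ₗ-trans []<∷ (head< _) = []<∷
  <ₗ-trans []<∷ (tail< _) = []<∷
  <ₗ-trans (head< p) (head< q) = head< (FP.<-trans p q)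
  <ₗ-trans (head< p) (tail< _) = head< p
  <ₗ-trans (tail< _) (head< q) = head< q
  <ₗ-trans (tail< p) (tail< q) = tail< (<ₗ-trans p q)

  <ₗ-cmp : Trichotomous _≡_ _<ₗ_
  <ₗ-cmp [] [] = tri≈ (λ ()) refl (λ ())
  <ₗ-cmp [] (y ∷ ys) = tri< []<∷ (λ ()) (λ ())
  <ₗ-cmp (x ∷ xs) [] = tri> (λ ()) (λ ()) []<∷
  <ₗ-cmp (x ∷ xs) (y ∷ ys) with FP.<-cmp x y
  ... | tri< x<y _ _ = tri< (head< x<y) (λ { refl → FP.<-irrefl refl x<y })
    λ { (head< y<x) → FP.<-asym x<y y<x ; (tail< _) → FP.<-irrefl refl x<y }
  ... | tri> _ _ y<x = tri> (λ { (head< x<y) → FP.<-asym x<y y<x ; (tail< _) → FP.<-irrefl refl y<x })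
    (λ { refl → FP.<-irrefl refl y<x }) (head< y<x)
  ... | tri≈ _ refl _ with <ₗ-cmp xs ys
  ...   | tri< xs<ys xs≢ys xs≯ys = tri< (tail< xs<ys) (xs≢ys ∘ LP.∷-injectiveʳ)
    λ { (head< x<x) → FP.<-irrefl refl x<x ; (tail< ys<xs) → xs≯ys ys<xs }
  ...   | tri≈ _ refl _ = tri≈ <ₗ-irrefl refl <ₗ-irrefl
  ...   | tri> xs≮ys xs≢ys ys<xs = tri> (λ { (head< x<x) → FP.<-irrefl refl x<x ; (tail< xs<ys) → xs≮ys xs<ys })
    (xs≢ys ∘ LP.∷-injectiveʳ) (tail< ys<xs)

  <ₗ-isStrictTotalOrder : IsStrictTotalOrder _≡_ _<ₗ_
  <ₗ-isStrictTotalOrder = record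
    { isStrictPartialOrder = record
      { isEquivalence = P.isEquivalence
      ; irrefl = λ { refl → <ₗ-irrefl }
      ; trans = <ₗ-trans
      ; <-resp-≈ = P.resp₂ _<ₗ_ }
    ; compare = <ₗ-cmp }

  lexDecTotalOrder : DecTotalOrder _ _ _
  lexDecTotalOrder = record
    { isDecTotalOrder = StrictToNonStrict.isDecTotalOrder _≡_ _<ₗ_ <ₗ-isStrictTotalOrder }

  open DecTotalOrder lexDecTotalOrder public
    using () renaming (refl to ≤ₗ-refl; trans to ≤ₗ-trans; antisym to ≤ₗ-antisym)

  <ₗ-≤ₗ-trans : ∀ {xs ys zs} → xs <ₗ ys → ys ≤ₗ zs → xs <ₗ zs
  <ₗ-≤ₗ-trans = StrictToNonStrict.<-≤-trans _≡_ _<ₗ_ <ₗ-trans (subst (_ <ₗ_))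

  <ₗ⇒≱ₗ : ∀ {xs ys} → xs <ₗ ys → ¬ ys ≤ₗ xs
  <ₗ⇒≱ₗ p (inj₁ q) = <ₗ-irrefl (<ₗ-trans p q)
  <ₗ⇒≱ₗ p (inj₂ refl) = <ₗ-irrefl p

  xs≤ₗxs++ys : ∀ xs ys → xs ≤ₗ xs ++ ys
  xs≤ₗxs++ys [] [] = inj₂ refl
  xs≤ₗxs++ys [] (y ∷ ys) = inj₁ []<∷
  xs≤ₗxs++ys (x ∷ xs) ys with xs≤ₗxs++ys xs ys
  ... | inj₁ p = inj₁ (tail< p)
  ... | inj₂ e = inj₂ (cong (x ∷_) e)

  ++-cancelˡ-≤ₗ : ∀ ws {xs ys} → ws ++ xs ≤ₗ ws ++ ys → xs ≤ₗ ys
  ++-cancelˡ-≤ₗ [] p = p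
  ++-cancelˡ-≤ₗ (w ∷ ws) (inj₁ (head< w<w)) = ⊥-elim (FP.<-irrefl refl w<w)
  ++-cancelˡ-≤ₗ (w ∷ ws) (inj₁ (tail< p)) = ++-cancelˡ-≤ₗ ws (inj₁ p)
  ++-cancelˡ-≤ₗ (w ∷ ws) (inj₂ e) = inj₂ (LP.++-cancelˡ (w ∷ ws) _ _ e)

  <ₗ-prefix-or-mismatch : ∀ {xs ys} → xs <ₗ ys →
    (∃ λ e → e ≢ [] × ys ≡ xs ++ e) ⊎ (∀ a b → xs ++ a <ₗ ys ++ b)
  <ₗ-prefix-or-mismatch ([]<∷ {y} {ys}) = inj₁ (y ∷ ys , (λ ()) , refl)
  <ₗ-prefix-or-mismatch (head< x<y) = inj₂ (λ _ _ → head< x<y)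
  <ₗ-prefix-or-mismatch (tail< p) with <ₗ-prefix-or-mismatch p
  ... | inj₁ (e , e≢[] , refl) = inj₁ (e , e≢[] , refl)
  ... | inj₂ f = inj₂ (λ a b → tail< (f a b))

  <ₗ-or-≥ₗ : ∀ xs ys → xs <ₗ ys ⊎ ys ≤ₗ xs
  <ₗ-or-≥ₗ xs ys with <ₗ-cmp xs ys
  ... | tri< p _ _ = inj₁ p
  ... | tri≈ _ e _ = inj₂ (inj₂ (sym e))
  ... | tri> _ _ q = inj₂ (inj₁ q)

-- Lyndon factorisation

module _ {k : ℕ} where

  Suffix : Word k → Word k → Set
  Suffix t w = ∃ λ p → w ≡ p ++ t

  infix 4 _≤ₗ-suffixes_

  _≤ₗ-suffixes_ : Word k → Word k → Set
  s ≤ₗ-suffixes w = ∀ t → t ≢ [] → Suffix t w → s ≤ₗ t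

  Lyndon : Word k → Set
  Lyndon l = l ≢ [] × (∀ p t → l ≡ p ++ t → p ≢ [] → t ≢ [] → l <ₗ t)

  -- A factorisation is listed from its last factor to its first, so that
  -- the Lyndon factorisation is a list sorted in increasing order.
  concatRev : List (Word k) → Word k
  concatRev [] = []
  concatRev (l ∷ R) = concatRev R ++ l

  LyndonFactorisation : List (Word k) → Set
  LyndonFactorisation R = All Lyndon R × Linked _≤ₗ_ R

  suffix-∷ : ∀ {t x w} → Suffix t (x ∷ w) → t ≡ x ∷ w ⊎ Suffix t w
  suffix-∷ ([] , e) = inj₁ (sym e)
  suffix-∷ (_ ∷ p , e) = inj₂ (p , LP.∷-injectiveʳ e)

  suffix-trans : ∀ {t u w} → Suffix t u → Suffix u w → Suffix t w
  suffix-trans {t} (q , refl) (p , refl) = p ++ q , sym (LP.++-assoc p q t)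

  ≤ₗ-suffixes-restrict : ∀ {s u w} → s ≤ₗ-suffixes w → Suffix u w → s ≤ₗ-suffixes u
  ≤ₗ-suffixes-restrict s≤ u⊑w t t≢[] t⊑u = s≤ t t≢[] (suffix-trans t⊑u u⊑w)

  lyndon⇒≤ₗ-suffixes : ∀ {l} → Lyndon l → l ≤ₗ-suffixes l
  lyndon⇒≤ₗ-suffixes _ t _ ([] , refl) = ≤ₗ-refl
  lyndon⇒≤ₗ-suffixes (_ , l<suffix) t t≢[] (x ∷ p , l≡) = inj₁ (l<suffix (x ∷ p) t l≡ (λ ()) t≢[])

  ≤ₗ-suffixes⇒lyndon : ∀ {s} → s ≢ [] → s ≤ₗ-suffixes s → Lyndon s
  ≤ₗ-suffixes⇒lyndon s≢[] s≤ = s≢[] , strict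
    where
    strict : ∀ p t → _ ≡ p ++ t → p ≢ [] → t ≢ [] → _ <ₗ t
    strict p t s≡p++t p≢[] t≢[] with s≤ t t≢[] (p , s≡p++t)
    ... | inj₁ s<t = s<t
    ... | inj₂ refl = ⊥-elim (ℕP.<-irrefl (cong length s≡p++t) (length<length-++ˡ p p≢[]))

  minimalSuffix : ∀ w → w ≢ [] → ∃ λ s → s ≢ [] × Suffix s w × s ≤ₗ-suffixes w
  minimalSuffix [] w≢[] = ⊥-elim (w≢[] refl)
  minimalSuffix (x ∷ []) _ = x ∷ [] , (λ ()) , ([] , refl) , x∷[]-minimal
    where
    x∷[]-minimal : x ∷ [] ≤ₗ-suffixes x ∷ []
    x∷[]-minimal t t≢[] t⊑x with suffix-∷ t⊑x
    ... | inj₁ refl = ≤ₗ-refl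
    ... | inj₂ ([] , refl) = ⊥-elim (t≢[] refl)
  minimalSuffix (x ∷ w@(_ ∷ _)) _ with minimalSuffix w (λ ())
  ... | s , s≢[] , (p , w≡p++s) , s-min with <ₗ-or-≥ₗ (x ∷ w) s
  ...   | inj₁ x∷w<s = x ∷ w , (λ ()) , ([] , refl) , x∷w-minimal
    where
    x∷w-minimal : x ∷ w ≤ₗ-suffixes x ∷ w
    x∷w-minimal t t≢[] t⊑x∷w with suffix-∷ t⊑x∷w
    ... | inj₁ refl = ≤ₗ-refl
    ... | inj₂ t⊑w = inj₁ (<ₗ-≤ₗ-trans x∷w<s (s-min t t≢[] t⊑w))
  ...   | inj₂ s≤x∷w = s , s≢[] , (x ∷ p , cong (x ∷_) w≡p++s) , s-min′
    where
    s-min′ : s ≤ₗ-suffixes x ∷ w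
    s-min′ t t≢[] t⊑x∷w with suffix-∷ t⊑x∷w
    ... | inj₁ refl = s≤x∷w
    ... | inj₂ t⊑w = s-min t t≢[] t⊑w

  -- The only nontrivial case is s = t e: then s ≤ t s gives e ≤ t e, while
  -- minimality of s against its suffix e gives t e ≤ e, so t = [].
  ≤ₗ-suffixes-≤ₗ-prefix : ∀ {s} t → t ≢ [] → s ≤ₗ-suffixes s → s ≤ₗ t ++ s → s ≤ₗ t
  ≤ₗ-suffixes-≤ₗ-prefix {s} t t≢[] s-min s≤ts with <ₗ-or-≥ₗ t s
  ... | inj₂ s≤t = s≤t
  ... | inj₁ t<s with <ₗ-prefix-or-mismatch t<s
  ...   | inj₂ mismatch = ⊥-elim (<ₗ⇒≱ₗ (subst (t ++ s <ₗ_) (LP.++-identityʳ s) (mismatch s [])) s≤ts)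
  ...   | inj₁ (e , e≢[] , refl) = ⊥-elim (t≢[] (LP.++-identityˡ-unique t (≤ₗ-antisym e≤te te≤e)))
    where
    e≤te : e ≤ₗ t ++ e
    e≤te = ++-cancelˡ-≤ₗ t s≤ts
    te≤e : t ++ e ≤ₗ e
    te≤e = s-min e e≢[] (t , refl)

  -- Split off the minimal nonempty suffix and factorise what remains.
  lyndonFactorisation′ : ∀ n w → length w ≤ n →
    ∃ λ R → LyndonFactorisation R × concatRev R ≡ w
  lyndonFactorisation′ _ [] _ = [] , ([] , []) , refl
  lyndonFactorisation′ (suc n) w@(_ ∷ _) |w|≤1+n with minimalSuffix w (λ ())
  ... | s , s≢[] , (p , w≡p++s) , s-min with lyndonFactorisation′ n p |p|≤n
    where
    |p|≤n : length p ≤ n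
    |p|≤n = ℕ.s≤s⁻¹ (ℕP.<-≤-trans (subst (length p ℕ.<_) (cong length (sym w≡p++s))
                      (length<length-++ʳ p s≢[])) |w|≤1+n)
  ... | R , (lyndons , linked) , R≡p =
    s ∷ R , (lyndon-s ∷ lyndons , link R lyndons linked R≡p) , trans (cong (_++ s) R≡p) (sym w≡p++s)
    where
    lyndon-s : Lyndon s
    lyndon-s = ≤ₗ-suffixes⇒lyndon s≢[] (≤ₗ-suffixes-restrict s-min (p , w≡p++s))
    link : ∀ R → All Lyndon R → Linked _≤ₗ_ R → concatRev R ≡ p → Linked _≤ₗ_ (s ∷ R)
    link [] _ _ _ = [-]
    link (l ∷ R) ((l≢[] , _) ∷ _) linked refl = s≤l ∷ linked
      where
      s≤l : s ≤ₗ l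
      s≤l = ≤ₗ-suffixes-≤ₗ-prefix l l≢[] (lyndon⇒≤ₗ-suffixes lyndon-s)
              (s-min (l ++ s) (λ e → l≢[] (LP.++-conicalˡ l s e))
                     (concatRev R , trans w≡p++s (LP.++-assoc (concatRev R) l s)))

  lyndonFactorisation : ∀ w → ∃ λ R → LyndonFactorisation R × concatRev R ≡ w
  lyndonFactorisation w = lyndonFactorisation′ (length w) w ℕP.≤-refl

  ≤ₗ-suffixes-[] : ∀ {s} → s ≤ₗ-suffixes []
  ≤ₗ-suffixes-[] t t≢[] (q , []≡q++t) = ⊥-elim (t≢[] (LP.++-conicalʳ q t (sym []≡q++t)))

  last-factor-≤ₗ-suffixes : ∀ {l} R → All Lyndon (l ∷ R) → Linked _≤ₗ_ (l ∷ R) →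
                             l ≤ₗ-suffixes concatRev (l ∷ R)
  last-factor-≤ₗ-suffixes-of-rest : ∀ {l} R → All Lyndon R → Linked _≤ₗ_ (l ∷ R) →
                        l ≤ₗ-suffixes concatRev R

  last-factor-≤ₗ-suffixes {l} R (lyndon-l ∷ lyndons) linked t t≢[] (q , e)
    with levi (concatRev R) l q t e
  ... | inj₁ (e , _ , l≡e++t) = lyndon⇒≤ₗ-suffixes lyndon-l t t≢[] (e , l≡e++t)
  ... | inj₂ ([] , _ , refl) = ≤ₗ-refl
  ... | inj₂ (x ∷ e , R≡q++e , refl) =
    ≤ₗ-trans (last-factor-≤ₗ-suffixes-of-rest R lyndons linked (x ∷ e) (λ ()) (q , R≡q++e))
             (xs≤ₗxs++ys (x ∷ e) l)

  last-factor-≤ₗ-suffixes-of-rest [] _ _ = ≤ₗ-suffixes-[]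
  last-factor-≤ₗ-suffixes-of-rest (l₂ ∷ R) lyndons (l≤l₂ ∷ linked) t t≢[] t⊑R =
    ≤ₗ-trans l≤l₂ (last-factor-≤ₗ-suffixes R lyndons linked t t≢[] t⊑R)

  lyndonFactorisation-unique : ∀ R R′ → LyndonFactorisation R → LyndonFactorisation R′ →
                               concatRev R ≡ concatRev R′ → R ≡ R′
  lyndonFactorisation-unique [] [] _ _ _ = refl
  lyndonFactorisation-unique [] (l′ ∷ R′) _ ((l′≢[] , _) ∷ _ , _) e =
    ⊥-elim (l′≢[] (LP.++-conicalʳ (concatRev R′) l′ (sym e)))
  lyndonFactorisation-unique (l ∷ R) [] ((l≢[] , _) ∷ _ , _) _ e =
    ⊥-elim (l≢[] (LP.++-conicalʳ (concatRev R) l e))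
  lyndonFactorisation-unique (l ∷ R) (l′ ∷ R′) (ls@((l≢[] , _) ∷ lyndons) , linked)
                                              (ls′@((l′≢[] , _) ∷ lyndons′) , linked′) e =
    cong₂ _∷_ l≡l′
      (lyndonFactorisation-unique R R′ (lyndons , Linked.tail linked) (lyndons′ , Linked.tail linked′) e′)
    where
    l≡l′ : l ≡ l′
    l≡l′ = ≤ₗ-antisym (last-factor-≤ₗ-suffixes R ls linked l′ l′≢[] (concatRev R′ , e))
                      (last-factor-≤ₗ-suffixes R′ ls′ linked′ l l≢[] (concatRev R , sym e))
    e′ : concatRev R ≡ concatRev R′
    e′ = LP.++-cancelʳ l (concatRev R) (concatRev R′) (trans e (cong (concatRev R′ ++_) (sym l≡l′)))

-- Powers and rotations

pow : ∀ {A : Set} → List A → ℕ → List A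
pow u r = L.concat (L.replicate r u)

module _ {A : Set} where

  pow-sucʳ : ∀ (u : List A) r → pow u (suc r) ≡ pow u r ++ u
  pow-sucʳ u zero = LP.++-identityʳ u
  pow-sucʳ u (suc r) = trans (cong (u ++_) (pow-sucʳ u r)) (sym (LP.++-assoc u (pow u r) u))

  pow-+ : ∀ (u : List A) m n → pow u m ++ pow u n ≡ pow u (m + n)
  pow-+ u zero n = refl
  pow-+ u (suc m) n = trans (LP.++-assoc u (pow u m) (pow u n)) (cong (u ++_) (pow-+ u m n))

  pow-[] : ∀ r → pow ([] {A = A}) r ≡ []
  pow-[] zero = refl
  pow-[] (suc r) = pow-[] r

  pow-suc-≢[] : ∀ {u : List A} r → u ≢ [] → pow u (suc r) ≢ []
  pow-suc-≢[] {u} r u≢[] e = u≢[] (LP.++-conicalˡ u (pow u r) e)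

  pow-rotate-letter : ∀ (x : A) z r → pow (x ∷ z) r ++ x ∷ [] ≡ x ∷ pow (z ++ x ∷ []) r
  pow-rotate-letter x z zero = refl
  pow-rotate-letter x z (suc r) = cong (x ∷_) (begin
    (z ++ pow (x ∷ z) r) ++ x ∷ []    ≡⟨ LP.++-assoc z _ _ ⟩
    z ++ (pow (x ∷ z) r ++ x ∷ [])    ≡⟨ cong (z ++_) (pow-rotate-letter x z r) ⟩
    z ++ x ∷ pow (z ++ x ∷ []) r      ≡⟨ LP.++-assoc z (x ∷ []) _ ⟨
    (z ++ x ∷ []) ++ pow (z ++ x ∷ []) r ∎)
    where open P.≡-Reasoning

  rotate-pow : ∀ r a b (z : List A) → a ++ b ≡ pow z r →
               ∃ λ z′ → length z′ ≡ length z × b ++ a ≡ pow z′ r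
  rotate-pow r [] b z e = z , refl , trans (LP.++-identityʳ b) e
  rotate-pow r (x ∷ a) b [] e with trans e (pow-[] r)
  ... | ()
  rotate-pow (suc r) (x ∷ a) b (y ∷ z) e with LP.∷-injective e
  ... | refl , a++b≡ with rotate-pow (suc r) a (b ++ x ∷ []) (z ++ x ∷ []) shifted
    where
    shifted : a ++ (b ++ x ∷ []) ≡ pow (z ++ x ∷ []) (suc r)
    shifted = trans (sym (LP.++-assoc a b (x ∷ [])))
      (LP.∷-injectiveʳ (trans (cong (λ v → x ∷ (v ++ x ∷ [])) a++b≡) (pow-rotate-letter x z (suc r))))
  ... | z′ , |z′| , e′ = z′ , trans |z′| (trans (LP.length-++ z) (ℕP.+-comm (length z) 1))
                        , trans (sym (LP.++-assoc b (x ∷ []) a)) e′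

  commuting⇒powers′ : ∀ n (p t : List A) → length (p ++ t) ≤ n → p ++ t ≡ t ++ p → p ≢ [] → t ≢ [] →
                      ∃ λ z → ∃ λ i → ∃ λ j → p ≡ pow z (suc i) × t ≡ pow z (suc j)
  commuting⇒powers′ _ [] _ _ _ p≢[] _ = ⊥-elim (p≢[] refl)
  commuting⇒powers′ zero (_ ∷ _) _ () _ _ _
  commuting⇒powers′ (suc n) p t |pt|≤1+n pt≡tp p≢[] t≢[] with levi p t t p pt≡tp
  ... | inj₁ ([] , t≡p++[] , _) = p , 0 , 0 , sym (LP.++-identityʳ p) , t≡p++[]
  ... | inj₂ ([] , p≡t++[] , _) = t , 0 , 0 , p≡t++[] , sym (LP.++-identityʳ t)
  ... | inj₁ (e@(_ ∷ _) , refl , t≡e++p)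
    with commuting⇒powers′ n p e (ℕ.s≤s⁻¹ (ℕP.<-≤-trans (length<length-++ˡ p p≢[]) |pt|≤1+n))
                          t≡e++p p≢[] (λ ())
  ...   | z , i , j , refl , e≡z^j = z , i , i + suc j , refl
                                  , trans (cong (pow z (suc i) ++_) e≡z^j) (pow-+ z (suc i) (suc j))
  commuting⇒powers′ (suc n) p t |pt|≤1+n pt≡tp p≢[] t≢[] | inj₂ (e@(_ ∷ _) , refl , p≡e++t)
    with commuting⇒powers′ n t e (ℕ.s≤s⁻¹ (ℕP.<-≤-trans (length<length-++ʳ p t≢[]) |pt|≤1+n))
                          p≡e++t t≢[] (λ ())
  ... | z , i , j , refl , e≡z^j = z , i + suc j , i
                                , trans (cong (pow z (suc i) ++_) e≡z^j) (pow-+ z (suc i) (suc j)) , refl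

  commuting⇒powers : ∀ (p t : List A) → p ++ t ≡ t ++ p → p ≢ [] → t ≢ [] →
                     ∃ λ z → ∃ λ i → ∃ λ j → p ≡ pow z (suc i) × t ≡ pow z (suc j)
  commuting⇒powers p t = commuting⇒powers′ (length (p ++ t)) p t ℕP.≤-refl

  ≢[]-resp-length : ∀ {u v : List A} → length u ≡ length v → u ≢ [] → v ≢ []
  ≢[]-resp-length {[]} _ u≢[] = ⊥-elim (u≢[] refl)
  ≢[]-resp-length {_ ∷ _} {_ ∷ _} _ _ ()

module _ {k : ℕ} where

  open NaturalChoiceMin (DecTotalOrder.totalOrder (lexDecTotalOrder {k})) using (_⊓_; x⊓y≤x; x⊓y≤y; ⊓-sel)

  lyndon⇒oneRepeating : ∀ {l : Word k} → Lyndon l → OneRepeating l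
  lyndon⇒oneRepeating _ (suc zero , _ , s≤s () , _)
  lyndon⇒oneRepeating (l≢[] , l<suffix) (suc (suc r) , u , _ , _ , refl) = <ₗ⇒≱ₗ l<u^r+1 u^r+1≤l
    where
    u≢[] : u ≢ []
    u≢[] refl = l≢[] (pow-[] (suc (suc r)))
    l<u^r+1 : pow u (suc (suc r)) <ₗ pow u (suc r)
    l<u^r+1 = l<suffix u (pow u (suc r)) refl u≢[] (pow-suc-≢[] r u≢[])
    u^r+1≤l : pow u (suc r) ≤ₗ pow u (suc (suc r))
    u^r+1≤l = subst (pow u (suc r) ≤ₗ_) (sym (pow-sucʳ u (suc r))) (xs≤ₗxs++ys (pow u (suc r)) u)

  pow-¬oneRepeating : ∀ {z : Word k} r → z ≢ [] → ¬ OneRepeating (pow z (suc (suc r)))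
  pow-¬oneRepeating {z} r z≢[] oneRepeating =
    oneRepeating (suc (suc r) , z , s≤s (s≤s z≤n) , length<length-++ʳ z (pow-suc-≢[] r z≢[]) , refl)

  rot-refl : ∀ {w : Word k} → Rot w w
  rot-refl {w} = [] , w , refl , sym (LP.++-identityʳ w)

  rot-sym : ∀ {w r : Word k} → Rot w r → Rot r w
  rot-sym (a , b , e₁ , e₂) = b , a , e₂ , e₁

  rot-trans : ∀ {w r s : Word k} → Rot w r → Rot r s → Rot w s
  rot-trans (a , b , refl , b++a≡) (c , d , c++d≡ , refl) with levi b a c d (trans (sym b++a≡) c++d≡)
  ... | inj₁ (e , refl , refl) = e , d ++ b , LP.++-assoc e d b , sym (LP.++-assoc d b e)
  ... | inj₂ (e , refl , refl) = a ++ c , e , sym (LP.++-assoc a c e) , LP.++-assoc e a c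

  rot-length : ∀ {w r : Word k} → Rot w r → length w ≡ length r
  rot-length (a , b , refl , refl) =
    trans (LP.length-++ a) (trans (ℕP.+-comm (length a) (length b)) (sym (LP.length-++ b)))

  oneRepeating⇒¬commuting-rotation : ∀ {w p t : Word k} → OneRepeating w → Rot w (p ++ t) →
                                     p ++ t ≡ t ++ p → p ≢ [] → t ≢ [] → ⊥
  oneRepeating⇒¬commuting-rotation {p = p} {t} oneRepeating (a , b , refl , pt≡ba) pt≡tp p≢[] t≢[]
    with commuting⇒powers p t pt≡tp p≢[] t≢[]
  ... | z , i , j , refl , refl with rotate-pow (suc (suc (i + j))) b a z (trans (sym pt≡ba) pt≡z^r)
    where
    pt≡z^r : pow z (suc i) ++ pow z (suc j) ≡ pow z (suc (suc (i + j)))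
    pt≡z^r = trans (pow-+ z (suc i) (suc j)) (cong (λ m → pow z (suc m)) (ℕP.+-suc i j))
  ... | z′ , |z′|≡|z| , ab≡z′^r =
    pow-¬oneRepeating (i + j) z′≢[] (subst OneRepeating ab≡z′^r oneRepeating)
    where
    z′≢[] : z′ ≢ []
    z′≢[] = ≢[]-resp-length (sym |z′|≡|z|) z≢[]
      where
      z≢[] : z ≢ []
      z≢[] refl = p≢[] (pow-[] (suc i))

  -- The least of the rotations d ++ a ++ c over all splittings c ++ d of the second argument.
  minRotation′ : Word k → Word k → Word k
  minRotation′ a [] = a
  minRotation′ a (x ∷ b) = ((x ∷ b) ++ a) ⊓ minRotation′ (a ++ x ∷ []) b

  minRotation′-rot : ∀ a b → Rot (a ++ b) (minRotation′ a b)
  minRotation′-rot a [] = a , [] , refl , refl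
  minRotation′-rot a (x ∷ b) with ⊓-sel ((x ∷ b) ++ a) (minRotation′ (a ++ x ∷ []) b)
  ... | inj₁ e = a , x ∷ b , refl , e
  ... | inj₂ e = subst₂ Rot (LP.++-assoc a (x ∷ []) b) (sym e) (minRotation′-rot (a ++ x ∷ []) b)

  minRotation′-≤ₗ : ∀ a b c d → c ++ d ≡ b → minRotation′ a b ≤ₗ d ++ (a ++ c)
  minRotation′-≤ₗ a [] [] [] refl = subst (a ≤ₗ_) (sym (LP.++-identityʳ a)) ≤ₗ-refl
  minRotation′-≤ₗ a (x ∷ b) [] d refl =
    ≤ₗ-trans (x⊓y≤x ((x ∷ b) ++ a) (minRotation′ (a ++ x ∷ []) b))
             (inj₂ (cong ((x ∷ b) ++_) (sym (LP.++-identityʳ a))))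
  minRotation′-≤ₗ a (x ∷ b) (y ∷ c) d e with LP.∷-injective e
  ... | refl , c++d≡b = ≤ₗ-trans (x⊓y≤y ((x ∷ b) ++ a) (minRotation′ (a ++ x ∷ []) b))
    (subst (λ v → minRotation′ (a ++ x ∷ []) b ≤ₗ d ++ v) (LP.++-assoc a (x ∷ []) c)
      (minRotation′-≤ₗ (a ++ x ∷ []) b c d c++d≡b))

  minRotation : Word k → Word k
  minRotation w = minRotation′ [] w

  minRotation-rot : ∀ w → Rot w (minRotation w)
  minRotation-rot w = minRotation′-rot [] w

  minRotation-≤ₗ : ∀ w r → Rot w r → minRotation w ≤ₗ r
  minRotation-≤ₗ w r (c , d , w≡cd , refl) = minRotation′-≤ₗ [] w c d (sym w≡cd)

  minRotation-cong : ∀ {w w′} → Rot w w′ → minRotation w ≡ minRotation w′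
  minRotation-cong {w} {w′} w~w′ = ≤ₗ-antisym
    (minRotation-≤ₗ w (minRotation w′) (rot-trans w~w′ (minRotation-rot w′)))
    (minRotation-≤ₗ w′ (minRotation w) (rot-trans (rot-sym w~w′) (minRotation-rot w)))

  <ₗ-++-same-length : ∀ {x p : Word k} a b → length x ≡ length p → x <ₗ p → x ++ a <ₗ p ++ b
  <ₗ-++-same-length {x} a b |x|≡|p| x<p with <ₗ-prefix-or-mismatch x<p
  ... | inj₂ mismatch = mismatch a b
  ... | inj₁ (e , e≢[] , refl) = ⊥-elim (ℕP.<-irrefl |x|≡|p| (length<length-++ʳ x e≢[]))

  -- If the least rotation m = p t were not below t, then t would be a prefix of m, say
  -- m = t x; minimality of m among its rotations forces x = p, so p and t commute.
  oneRepeating⇒lyndon-minRotation : ∀ w → w ≢ [] → OneRepeating w → Lyndon (minRotation w)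
  oneRepeating⇒lyndon-minRotation w w≢[] oneRepeating =
    ≢[]-resp-length (rot-length w~m) w≢[] , m<suffix
    where
    m = minRotation w
    w~m : Rot w m
    w~m = minRotation-rot w
    m-minimal : ∀ c d → m ≡ c ++ d → m ≤ₗ d ++ c
    m-minimal c d m≡cd = minRotation-≤ₗ w (d ++ c) (rot-trans w~m (c , d , m≡cd , refl))
    m<suffix : ∀ p t → m ≡ p ++ t → p ≢ [] → t ≢ [] → m <ₗ t
    m<suffix p t m≡pt p≢[] t≢[] with <ₗ-cmp m t
    ... | tri< m<t _ _ = m<t
    ... | tri≈ _ refl _ = ⊥-elim (ℕP.<-irrefl (cong length m≡pt) (length<length-++ˡ p p≢[]))
    ... | tri> _ _ t<m with <ₗ-prefix-or-mismatch t<m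
    ...   | inj₂ mismatch =
      ⊥-elim (<ₗ⇒≱ₗ (subst (t ++ p <ₗ_) (LP.++-identityʳ m) (mismatch p [])) (m-minimal p t m≡pt))
    ...   | inj₁ (x , _ , m≡tx) = ⊥-elim
      (oneRepeating⇒¬commuting-rotation oneRepeating (subst (Rot w) m≡pt w~m)
        (subst (λ v → p ++ t ≡ t ++ v) x≡p (trans (sym m≡pt) m≡tx)) p≢[] t≢[])
      where
      |x|≡|p| : length x ≡ length p
      |x|≡|p| = ℕP.+-cancelˡ-≡ (length t) _ _ (begin
        length t + length x  ≡⟨ LP.length-++ t ⟨
        length (t ++ x)      ≡⟨ cong length (trans (sym m≡tx) m≡pt) ⟩
        length (p ++ t)      ≡⟨ LP.length-++-comm p t ⟩
        length (t ++ p)      ≡⟨ LP.length-++ t ⟩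
        length t + length p  ∎)
        where open P.≡-Reasoning
      x≡p : x ≡ p
      x≡p with ++-cancelˡ-≤ₗ t (subst (_≤ₗ t ++ p) m≡tx (m-minimal p t m≡pt))
      ... | inj₂ x≡p = x≡p
      ... | inj₁ x<p = ⊥-elim (<ₗ⇒≱ₗ (<ₗ-++-same-length t t |x|≡|p| x<p)
                                    (subst (_≤ₗ x ++ t) m≡pt (m-minimal t x m≡tx)))

  lyndon⇒minRotation≡ : ∀ {l} → Lyndon l → minRotation l ≡ l
  lyndon⇒minRotation≡ {l} (l≢[] , l<suffix) =
    ≤ₗ-antisym (minRotation-≤ₗ l l rot-refl) (l≤m (minRotation-rot l))
    where
    l≤m : ∀ {m} → Rot l m → l ≤ₗ m
    l≤m ([] , d , refl , refl) = inj₂ (sym (LP.++-identityʳ d))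
    l≤m (c@(_ ∷ _) , [] , refl , refl) = inj₂ (LP.++-identityʳ c)
    l≤m (c@(_ ∷ _) , d@(_ ∷ _) , l≡cd , refl) with <ₗ-prefix-or-mismatch (l<suffix c d l≡cd (λ ()) (λ ()))
    ... | inj₂ mismatch = inj₁ (subst (_<ₗ d ++ c) (LP.++-identityʳ l) (mismatch [] c))
    ... | inj₁ (e , _ , d≡le) =
      ⊥-elim (ℕP.<⇒≱ |d|<|l| (subst (length l ≤_) (cong length (sym d≡le)) (LP.length-++-≤ˡ l {e})))
      where
      |d|<|l| : length d ℕ.< length l
      |d|<|l| = subst (length d ℕ.<_) (cong length (sym l≡cd)) (length<length-++ˡ c (λ ()))

-- Canonical representatives of ornaments

module _ {k : ℕ} where

  open Sort (lexDecTotalOrder {k}) using (sort; sort-↭; sort-↗)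

  private
    module Necklace = Setoid (NecklaceSetoid k)
    module Ornament = Setoid (OrnamentSetoid k)
    open PermS (P.setoid (Word k)) using () renaming (_↭_ to _↭ₛ_)

  sorted-↭⇒≡ : ∀ {xs ys : List (Word k)} →
               Linked _≤ₗ_ xs → Linked _≤ₗ_ ys → xs ↭ₛ ys → xs ≡ ys
  sorted-↭⇒≡ xs↗ ys↗ xs↭ys =
    Pointwise-≡⇒≡ (SortedP.↗↭↗⇒≋ (DecTotalOrder.totalOrder lexDecTotalOrder) xs↗ ys↗ xs↭ys)

  minRotation-resp-≈ : ∀ {w w′} → w Necklace.≈ w′ → minRotation w ≡ minRotation w′
  minRotation-resp-≈ = EqClosure.gfold P.isEquivalence minRotation minRotation-cong

  canonical : Ornament k → List (Word k)
  canonical O = sort (L.map minRotation O)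

  canonical-cong : ∀ {O O′} → O Ornament.≈ O′ → canonical O ≡ canonical O′
  canonical-cong {O} {O′} O≈O′ = sorted-↭⇒≡ (sort-↗ _) (sort-↗ _) (begin
    sort (L.map minRotation O)   ↭⟨ ↭⇒↭ₛ (sort-↭ _) ⟩
    L.map minRotation O          ↭⟨ PermSP.map⁺ (NecklaceSetoid k) (P.setoid (Word k))
                                                 minRotation-resp-≈ O≈O′ ⟩
    L.map minRotation O′         ↭⟨ ↭⇒↭ₛ (sort-↭ _) ⟨
    sort (L.map minRotation O′)  ∎)
    where open PermS.PermutationReasoning (P.setoid (Word k))

  canonical-≈ : ∀ O → canonical O Ornament.≈ O
  canonical-≈ O =
    Ornament.trans (↭⇒↭ₛ′ Necklace.isEquivalence (sort-↭ (L.map minRotation O))) (map-minRotation-≈ O)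
    where
    map-minRotation-≈ : ∀ O → L.map minRotation O Ornament.≈ O
    map-minRotation-≈ [] = Ornament.refl
    map-minRotation-≈ (w ∷ O) = PermS.prep (fwd (rot-sym (minRotation-rot w)) ◅ ε) (map-minRotation-≈ O)

  canonical-↗ : ∀ O → Linked _≤ₗ_ (canonical O)
  canonical-↗ O = sort-↗ (L.map minRotation O)

  canonical-lyndon : ∀ {O} → All (λ w → NonEmpty w × OneRepeating w) O → All Lyndon (canonical O)
  canonical-lyndon {O} good = PermPP.All-resp-↭ (PermP.↭-sym (sort-↭ (L.map minRotation O))) (minRotations good)
    where
    minRotations : ∀ {O} → All (λ w → NonEmpty w × OneRepeating w) O → All Lyndon (L.map minRotation O)
    minRotations [] = []
    minRotations {w ∷ _} ((nonEmpty , oneRepeating) ∷ good) =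
      oneRepeating⇒lyndon-minRotation w (λ { refl → ℕP.<-irrefl refl nonEmpty }) oneRepeating ∷ minRotations good

  canonical-lyndonFactorisation : ∀ {R} → LyndonFactorisation R → canonical R ≡ R
  canonical-lyndonFactorisation {R} (lyndons , R↗) =
    sorted-↭⇒≡ (sort-↗ _) R↗ (↭⇒↭ₛ (subst (sort (L.map minRotation R) PermP.↭_)
                                          (map-minRotation-id lyndons) (sort-↭ _)))
    where
    map-minRotation-id : ∀ {R} → All Lyndon R → L.map minRotation R ≡ R
    map-minRotation-id [] = refl
    map-minRotation-id (lyndon ∷ lyndons) = cong₂ _∷_ (lyndon⇒minRotation≡ lyndon) (map-minRotation-id lyndons)

  countW-++ : ∀ c (u v : Word k) → countW c (u ++ v) ≡ countW c u + countW c v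
  countW-++ c [] v = refl
  countW-++ c (x ∷ u) v with c F.≟ x
  ... | yes _ = cong suc (countW-++ c u v)
  ... | no _ = countW-++ c u v

  countW-rot : ∀ c {w r : Word k} → Rot w r → countW c w ≡ countW c r
  countW-rot c (u , v , refl , refl) =
    trans (countW-++ c u v) (trans (ℕP.+-comm (countW c u) (countW c v)) (sym (countW-++ c v u)))

  countO-concatRev : ∀ c R → countO c R ≡ countW c (concatRev R)
  countO-concatRev c [] = refl
  countO-concatRev c (l ∷ R) = trans (ℕP.+-comm (countW c l) (countO c R))
    (trans (cong (_+ countW c l) (countO-concatRev c R)) (sym (countW-++ c (concatRev R) l)))

  countW-resp-≈ : ∀ c {w w′} → w Necklace.≈ w′ → countW c w ≡ countW c w′
  countW-resp-≈ c = EqClosure.gfold P.isEquivalence (countW c) (countW-rot c)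

  countO-resp-≈ : ∀ c {O O′} → O Ornament.≈ O′ → countO c O ≡ countO c O′
  countO-resp-≈ c (PermS.refl O≋O′) = pointwise O≋O′
    where
    pointwise : ∀ {O O′} → Pointwise Necklace._≈_ O O′ → countO c O ≡ countO c O′
    pointwise [] = refl
    pointwise (w≈w′ ∷ O≋O′) = cong₂ _+_ (countW-resp-≈ c w≈w′) (pointwise O≋O′)
  countO-resp-≈ c (PermS.prep w≈w′ p) = cong₂ _+_ (countW-resp-≈ c w≈w′) (countO-resp-≈ c p)
  countO-resp-≈ c (PermS.swap {x = u} {v} u≈u′ v≈v′ p) =
    trans (ℕCS.x∙yz≈y∙xz (countW c u) (countW c v) _)
          (cong₂ _+_ (countW-resp-≈ c v≈v′) (cong₂ _+_ (countW-resp-≈ c u≈u′) (countO-resp-≈ c p)))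
  countO-resp-≈ c (PermS.trans p q) = trans (countO-resp-≈ c p) (countO-resp-≈ c q)

-- Words and A-good ornaments

mkInverse : ∀ {a ℓ₁ b ℓ₂} (S : Setoid a ℓ₁) (T : Setoid b ℓ₂) →
            let open Setoid S using () renaming (Carrier to A; _≈_ to _≈₁_)
                open Setoid T using () renaming (Carrier to B; _≈_ to _≈₂_) in
            (to : A → B) (from : B → A) → Congruent _≈₁_ _≈₂_ to → Congruent _≈₂_ _≈₁_ from →
            StrictlyInverseˡ _≈₂_ to from → StrictlyInverseʳ _≈₁_ to from → Inverse S T
mkInverse S T to from to-cong from-cong to∘from from∘to = record
  { to = to ; from = from ; to-cong = to-cong ; from-cong = from-cong
  ; inverse = strictlyInverseˡ⇒inverseˡ to-cong to∘from , strictlyInverseʳ⇒inverseʳ from-cong from∘to }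
  where open import Function.Consequences.Setoid S T

HasContent : ∀ {k} → (Fin k → ℕ) → Word k → Set
HasContent A w = ∀ c → countW c w ≡ A c

WordSetoid : ∀ {k} → (Fin k → ℕ) → Setoid _ _
WordSetoid {k} A = On.setoid (P.setoid (Word k)) (proj₁ {B = HasContent A})

-- Lyndon factorisation, with necklaces of primitive words read through their least rotations.
words↔goodOrnaments : ∀ {k} (A : Fin k → ℕ) → Inverse (WordSetoid A) (GoodOrnamentSetoid A)
words↔goodOrnaments {k} A = mkInverse (WordSetoid A) (GoodOrnamentSetoid A) to from
  (λ w≡w′ → Setoid.reflexive (OrnamentSetoid k) (cong factors w≡w′))
  (λ O≈O′ → cong concatRev (canonical-cong O≈O′))
  (λ (O , _ , good) → subst (_≈ O) (sym (factors-canonical good)) (canonical-≈ O))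
  (λ (w , _) → trans (cong concatRev (canonical-lyndonFactorisation (factorisation w))) (concatRev-factors w))
  where
  open Setoid (OrnamentSetoid k) using (_≈_)
  factors : Word k → List (Word k)
  factors w = proj₁ (lyndonFactorisation w)
  factorisation : ∀ w → LyndonFactorisation (factors w)
  factorisation w = proj₁ (proj₂ (lyndonFactorisation w))
  concatRev-factors : ∀ w → concatRev (factors w) ≡ w
  concatRev-factors w = proj₂ (proj₂ (lyndonFactorisation w))
  factors-canonical : ∀ {O} → All (λ w → NonEmpty w × OneRepeating w) O →
                      factors (concatRev (canonical O)) ≡ canonical O
  factors-canonical {O} good = lyndonFactorisation-unique _ _ (factorisation (concatRev (canonical O)))
    (canonical-lyndon good , canonical-↗ O) (concatRev-factors _)
  good : ∀ {R} → All Lyndon R → All (λ w → NonEmpty w × OneRepeating w) R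
  good = All.map λ lyndon → ≢[]⇒length≥1 (proj₁ lyndon) , lyndon⇒oneRepeating lyndon
  to : Σ (Word k) (HasContent A) → Σ (Ornament k) (IsGood A)
  to (w , content) = factors w
    , (λ c → trans (countO-concatRev c (factors w)) (trans (cong (countW c) (concatRev-factors w)) (content c)))
    , good (proj₁ (factorisation w))
  from : Σ (Ornament k) (IsGood A) → Σ (Word k) (HasContent A)
  from (O , compatible , _) = concatRev (canonical O)
    , λ c → trans (sym (countO-concatRev c (canonical O))) (trans (countO-resp-≈ c (canonical-≈ O)) (compatible c))

total-cong : ∀ {k} {f g : Fin k → ℕ} → (∀ c → f c ≡ g c) → total f ≡ total g
total-cong {zero} _ = refl
total-cong {suc k} f≗g = cong₂ _+_ (f≗g fz) (total-cong (λ c → f≗g (fs c)))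

total-0 : ∀ {k} → total {k} (λ _ → 0) ≡ 0
total-0 {zero} = refl
total-0 {suc k} = total-0 {k}

δ : ∀ {k} → Fin k → Fin k → ℕ
δ c x with c F.≟ x
... | yes _ = 1
... | no _ = 0

δ-refl : ∀ {k} (c : Fin k) → δ c c ≡ 1
δ-refl c with c F.≟ c
... | yes _ = refl
... | no c≢c = ⊥-elim (c≢c refl)

δ-≢ : ∀ {k} {c x : Fin k} → c ≢ x → δ c x ≡ 0
δ-≢ {c = c} {x} c≢x with c F.≟ x
... | yes c≡x = ⊥-elim (c≢x c≡x)
... | no _ = refl

δ-suc : ∀ {k} (c x : Fin k) → δ (fs c) (fs x) ≡ δ c x
δ-suc c x with c F.≟ x
... | yes _ = refl
... | no _ = refl

total-δ : ∀ {k} (f : Fin k → ℕ) x → total (λ c → δ c x + f c) ≡ suc (total f)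
total-δ {suc k} f fz = cong₂ _+_ (cong (_+ f fz) (δ-refl {suc k} fz))
  (total-cong (λ c → cong (_+ f (fs c)) (δ-≢ {c = fs c} {fz} λ ())))
total-δ {suc k} f (fs x) = trans (cong₂ _+_ (cong (_+ f fz) (δ-≢ {c = fz} {fs x} λ ()))
  (trans (total-cong (λ c → cong (_+ f (fs c)) (δ-suc c x))) (total-δ (λ c → f (fs c)) x)))
  (ℕP.+-suc (f fz) _)

countW-∷ : ∀ {k} (c x : Fin k) w → countW c (x ∷ w) ≡ δ c x + countW c w
countW-∷ c x w with c F.≟ x
... | yes _ = refl
... | no _ = refl

total-countW : ∀ {k} (w : Word k) → total (λ c → countW c w) ≡ length w
total-countW {k} [] = total-0 {k}
total-countW (x ∷ w) =
  trans (total-cong (λ c → countW-∷ c x w)) (trans (total-δ (λ c → countW c w) x) (cong suc (total-countW w)))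

length-content : ∀ {k} {A : Fin k → ℕ} {w : Word k} → HasContent A w → length w ≡ total A
length-content {w = w} content = trans (sym (total-countW w)) (total-cong content)

block-exists : ∀ {k} (A : Fin k → ℕ) q → q ℕ.< total A → ∃ λ c → start A c ≤ q × q ℕ.< start A c + A c
block-exists {suc k} A q q<total with q ℕ.<? A fz
... | yes q<A₀ = fz , z≤n , q<A₀
... | no q≮A₀ with block-exists (λ i → A (fs i)) (q ∸ A fz) (ℕP.+-cancelˡ-< (A fz) _ _
                     (subst (ℕ._< total A) (sym (ℕP.m+[n∸m]≡n (ℕP.≮⇒≥ q≮A₀))) q<total))
... | c , lo , hi = fs c , lo′ , hi′
  where
  A₀≤q : A fz ≤ q
  A₀≤q = ℕP.≮⇒≥ q≮A₀
  lo′ : A fz + start (λ i → A (fs i)) c ≤ q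
  lo′ = subst (A fz + start (λ i → A (fs i)) c ≤_) (ℕP.m+[n∸m]≡n A₀≤q) (ℕP.+-monoʳ-≤ (A fz) lo)
  hi′ : q ℕ.< A fz + start (λ i → A (fs i)) c + A (fs c)
  hi′ = subst₂ ℕ._<_ (ℕP.m+[n∸m]≡n A₀≤q) (sym (ℕP.+-assoc (A fz) _ _)) (ℕP.+-monoʳ-< (A fz) hi)

block-unique : ∀ {k} (A : Fin k → ℕ) c c′ q → start A c ≤ q → q ℕ.< start A c + A c →
               start A c′ ≤ q → q ℕ.< start A c′ + A c′ → c ≡ c′
block-unique A fz fz q _ _ _ _ = refl
block-unique A fz (fs c′) q _ hi lo′ _ =
  ⊥-elim (ℕP.<-irrefl refl (ℕP.<-≤-trans hi (ℕP.≤-trans (ℕP.m≤m+n (A fz) _) lo′)))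
block-unique A (fs c) fz q lo _ _ hi′ =
  ⊥-elim (ℕP.<-irrefl refl (ℕP.<-≤-trans hi′ (ℕP.≤-trans (ℕP.m≤m+n (A fz) _) lo)))
block-unique A (fs c) (fs c′) q lo hi lo′ hi′ =
  cong fs (block-unique (λ i → A (fs i)) c c′ (q ∸ A fz)
                        (shift-lo lo) (shift-hi hi) (shift-lo lo′) (shift-hi hi′))
  where
  A₀+[q∸A₀]≡q : A fz + (q ∸ A fz) ≡ q
  A₀+[q∸A₀]≡q = ℕP.m+[n∸m]≡n (ℕP.≤-trans (ℕP.m≤m+n (A fz) _) lo)
  shift-lo : ∀ {s} → A fz + s ≤ q → s ≤ q ∸ A fz
  shift-lo le = ℕP.+-cancelˡ-≤ (A fz) _ _ (subst (_ ≤_) (sym A₀+[q∸A₀]≡q) le)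
  shift-hi : ∀ {s t} → q ℕ.< A fz + s + t → q ∸ A fz ℕ.< s + t
  shift-hi {s} {t} lt =
    ℕP.+-cancelˡ-< (A fz) _ _ (subst₂ ℕ._<_ (sym A₀+[q∸A₀]≡q) (ℕP.+-assoc (A fz) s t) lt)

start+size≤total : ∀ {k} (A : Fin k → ℕ) c → start A c + A c ≤ total A
start+size≤total A fz = ℕP.m≤m+n (A fz) _
start+size≤total A (fs c) = subst (_≤ total A) (sym (ℕP.+-assoc (A fz) _ _))
  (ℕP.+-monoʳ-≤ (A fz) (start+size≤total (λ i → A (fs i)) c))

infixl 5 _‼_

_‼_ : ∀ {X : Set} → List X → ℕ → Maybe X
[] ‼ _ = nothing
(x ∷ w) ‼ zero = just x
(x ∷ w) ‼ suc j = w ‼ j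

module _ {X : Set} where

  ‼-just⇒< : ∀ (w : List X) j {x} → w ‼ j ≡ just x → j ℕ.< length w
  ‼-just⇒< (_ ∷ w) zero _ = s≤s z≤n
  ‼-just⇒< (_ ∷ w) (suc j) e = s≤s (‼-just⇒< w j e)

  <⇒‼-just : ∀ (w : List X) j → j ℕ.< length w → ∃ λ x → w ‼ j ≡ just x
  <⇒‼-just (x ∷ w) zero _ = x , refl
  <⇒‼-just (x ∷ w) (suc j) (s≤s j<|w|) = <⇒‼-just w j j<|w|

  ≥⇒‼-nothing : ∀ (w : List X) j → length w ≤ j → w ‼ j ≡ nothing
  ≥⇒‼-nothing [] j _ = refl
  ≥⇒‼-nothing (x ∷ w) (suc j) (s≤s |w|≤j) = ≥⇒‼-nothing w j |w|≤j

  ‼-ext : ∀ (u v : List X) → (∀ j → u ‼ j ≡ v ‼ j) → u ≡ v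
  ‼-ext [] [] _ = refl
  ‼-ext [] (_ ∷ _) u≗v with u≗v 0
  ... | ()
  ‼-ext (_ ∷ _) [] u≗v with u≗v 0
  ... | ()
  ‼-ext (x ∷ u) (y ∷ v) u≗v = cong₂ _∷_ (MaybeP.just-injective (u≗v 0)) (‼-ext u v (λ j → u≗v (suc j)))

  ‼-tabulate : ∀ {n} (f : Fin n → X) j (j<n : j ℕ.< n) → L.tabulate f ‼ j ≡ just (f (F.fromℕ< j<n))
  ‼-tabulate {suc n} f zero _ = refl
  ‼-tabulate {suc n} f (suc j) (s≤s j<n) = ‼-tabulate (λ i → f (fs i)) j j<n

  ‼-tabulate-≥ : ∀ {n} (f : Fin n → X) j → n ≤ j → L.tabulate f ‼ j ≡ nothing
  ‼-tabulate-≥ {zero} f j _ = refl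
  ‼-tabulate-≥ {suc n} f (suc j) (s≤s n≤j) = ‼-tabulate-≥ (λ i → f (fs i)) j n≤j

module _ {k : ℕ} where

  countBefore : Word k → Fin k → ℕ → ℕ
  countBefore w c j = countW c (L.take j w)

  -- The position of the occurrence of c in w preceded by exactly r others.
  occurrence : Word k → Fin k → ℕ → ℕ
  occurrence [] c r = 0
  occurrence (x ∷ w) c r with c F.≟ x
  occurrence (x ∷ w) c zero | yes _ = 0
  occurrence (x ∷ w) c (suc r) | yes _ = suc (occurrence w c r)
  occurrence (x ∷ w) c r | no _ = suc (occurrence w c r)

  occurrence<length : ∀ w c r → r ℕ.< countW c w → occurrence w c r ℕ.< length w
  occurrence<length (x ∷ w) c r r< with c F.≟ x
  occurrence<length (x ∷ w) c zero r< | yes _ = s≤s z≤n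
  occurrence<length (x ∷ w) c (suc r) (s≤s r<) | yes _ = s≤s (occurrence<length w c r r<)
  occurrence<length (x ∷ w) c r r< | no _ = s≤s (occurrence<length w c r r<)

  ‼-occurrence : ∀ w c r → r ℕ.< countW c w → w ‼ occurrence w c r ≡ just c
  ‼-occurrence (x ∷ w) c r r< with c F.≟ x
  ‼-occurrence (x ∷ w) c zero r< | yes refl = refl
  ‼-occurrence (x ∷ w) c (suc r) (s≤s r<) | yes _ = ‼-occurrence w c r r<
  ‼-occurrence (x ∷ w) c r r< | no _ = ‼-occurrence w c r r<

  countBefore-occurrence : ∀ w c r → r ℕ.< countW c w → countBefore w c (occurrence w c r) ≡ r
  countBefore-occurrence (x ∷ w) c r r< with c F.≟ x
  countBefore-occurrence (x ∷ w) c zero r< | yes _ = refl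
  countBefore-occurrence (x ∷ w) c (suc r) (s≤s r<) | yes c≡x with c F.≟ x
  ... | yes _ = cong suc (countBefore-occurrence w c r r<)
  ... | no c≢x = ⊥-elim (c≢x c≡x)
  countBefore-occurrence (x ∷ w) c r r< | no c≢x with c F.≟ x
  ... | yes c≡x = ⊥-elim (c≢x c≡x)
  ... | no _ = countBefore-occurrence w c r r<

  occurrence-countBefore : ∀ w c j → w ‼ j ≡ just c → occurrence w c (countBefore w c j) ≡ j
  occurrence-countBefore (x ∷ w) c zero e with c F.≟ x
  ... | yes _ = refl
  ... | no c≢x = ⊥-elim (c≢x (sym (MaybeP.just-injective e)))
  occurrence-countBefore (x ∷ w) c (suc j) e with c F.≟ x
  ... | yes _ = cong suc (occurrence-countBefore w c j e)
  ... | no _ = cong suc (occurrence-countBefore w c j e)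

  countBefore<countW : ∀ w c j → w ‼ j ≡ just c → countBefore w c j ℕ.< countW c w
  countBefore<countW (x ∷ w) c zero e with c F.≟ x
  ... | yes _ = s≤s z≤n
  ... | no c≢x = ⊥-elim (c≢x (sym (MaybeP.just-injective e)))
  countBefore<countW (x ∷ w) c (suc j) e with c F.≟ x
  ... | yes _ = s≤s (countBefore<countW w c j e)
  ... | no _ = countBefore<countW w c j e

  countBefore-mono : ∀ w c {i j} → i ≤ j → countBefore w c i ≤ countBefore w c j
  countBefore-mono [] c {zero} _ = z≤n
  countBefore-mono [] c {suc _} {suc _} _ = z≤n
  countBefore-mono (x ∷ w) c {zero} _ = z≤n
  countBefore-mono (x ∷ w) c {suc i} {suc j} (s≤s i≤j) with c F.≟ x
  ... | yes _ = s≤s (countBefore-mono w c i≤j)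
  ... | no _ = countBefore-mono w c i≤j

  countBefore-suc-≡ : ∀ w c j → w ‼ j ≡ just c → countBefore w c (suc j) ≡ suc (countBefore w c j)
  countBefore-suc-≡ (x ∷ w) c zero e with c F.≟ x
  ... | yes _ = refl
  ... | no c≢x = ⊥-elim (c≢x (sym (MaybeP.just-injective e)))
  countBefore-suc-≡ (x ∷ w) c (suc j) e with c F.≟ x
  ... | yes _ = cong suc (countBefore-suc-≡ w c j e)
  ... | no _ = countBefore-suc-≡ w c j e

  countBefore-suc-≢ : ∀ w c {x} j → w ‼ j ≡ just x → c ≢ x → countBefore w c (suc j) ≡ countBefore w c j
  countBefore-suc-≢ (y ∷ w) c zero e c≢x with c F.≟ y
  ... | yes c≡y = ⊥-elim (c≢x (trans c≡y (MaybeP.just-injective e)))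
  ... | no _ = refl
  countBefore-suc-≢ (y ∷ w) c (suc j) e c≢x with c F.≟ y
  ... | yes _ = cong suc (countBefore-suc-≢ w c j e c≢x)
  ... | no _ = countBefore-suc-≢ w c j e c≢x

  countBefore-length : ∀ w c → countBefore w c (length w) ≡ countW c w
  countBefore-length w c = cong (countW c) (LP.take-all (length w) w ℕP.≤-refl)

  occurrence-mono : ∀ w c {r s} → r ℕ.< s → s ℕ.< countW c w → occurrence w c r ℕ.< occurrence w c s
  occurrence-mono w c {r} {s} r<s s< = ℕP.≰⇒> λ occ-s≤occ-r → ℕP.<⇒≱ r<s (subst₂ _≤_
    (countBefore-occurrence w c s s<) (countBefore-occurrence w c r (ℕP.<-trans r<s s<))
    (countBefore-mono w c occ-s≤occ-r))

  occurrence-colour : ∀ w {c d r s} → r ℕ.< countW c w → s ℕ.< countW d w →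
                      occurrence w c r ≡ occurrence w d s → c ≡ d
  occurrence-colour w {c} {d} {r} {s} r< s< e = MaybeP.just-injective
    (trans (sym (‼-occurrence w c r r<)) (trans (cong (w ‼_) e) (‼-occurrence w d s s<)))

  occurrence-injective : ∀ w c {r s} → r ℕ.< countW c w → s ℕ.< countW c w →
                         occurrence w c r ≡ occurrence w c s → r ≡ s
  occurrence-injective w c {r} {s} r< s< e =
    trans (sym (countBefore-occurrence w c r r<)) (trans (cong (countBefore w c) e) (countBefore-occurrence w c s s<))

module Enumeration {k : ℕ} (w : Word k) (c : Fin k) (a : ℕ) (J : ℕ → ℕ)
  (J-mono : ∀ r s → s ℕ.< a → r ℕ.< s → J r ℕ.< J s)
  (J-hit : ∀ r → r ℕ.< a → w ‼ J r ≡ just c)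
  (J-cover : ∀ j → w ‼ j ≡ just c → ∃ λ r → r ℕ.< a × J r ≡ j) where

  private
    J-bound : ∀ r → r ℕ.< a → J r ℕ.< length w
    J-bound r r<a = ‼-just⇒< w (J r) (J-hit r r<a)

  -- After the first j letters, the m copies of c read so far are those at J 0, …, J (m ∸ 1).
  Invariant : ℕ → Set
  Invariant j = Σ ℕ λ m → m ≤ a × countBefore w c j ≡ m ×
                          (∀ r → r ℕ.< m → J r ℕ.< j) × (m ℕ.< a → j ≤ J m)

  invariant : ∀ j → j ≤ length w → Invariant j
  invariant zero _ = 0 , z≤n , refl , (λ _ ()) , (λ _ → z≤n)
  invariant (suc j) j<|w| with invariant j (ℕP.<⇒≤ j<|w|) | <⇒‼-just w j j<|w|
  ... | m , m≤a , count≡m , below , above | x , w[j]≡x with c F.≟ x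
  ...   | no c≢x = m , m≤a , trans (countBefore-suc-≢ w c j w[j]≡x c≢x) count≡m
                   , (λ r r<m → ℕP.m<n⇒m<1+n (below r r<m)) , above′
    where
    above′ : m ℕ.< a → suc j ≤ J m
    above′ m<a with ℕP.m≤n⇒m<n∨m≡n (above m<a)
    ... | inj₁ j<Jm = j<Jm
    ... | inj₂ j≡Jm = ⊥-elim (c≢x (MaybeP.just-injective
                        (trans (sym (J-hit m m<a)) (trans (cong (w ‼_) (sym j≡Jm)) w[j]≡x))))
  ...   | yes refl with J-cover j w[j]≡x
  ...     | r , r<a , Jr≡j = suc m , subst (ℕ._< a) r≡m r<a
                             , trans (countBefore-suc-≡ w c j w[j]≡x) (cong suc count≡m) , below′ , above′
    where
    r≡m : r ≡ m
    r≡m with ℕP.<-cmp r m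
    ... | tri< r<m _ _ = ⊥-elim (ℕP.<-irrefl Jr≡j (below r r<m))
    ... | tri≈ _ r≡m _ = r≡m
    ... | tri> _ _ m<r =
      ⊥-elim (ℕP.<-irrefl (sym Jr≡j) (ℕP.≤-<-trans (above (ℕP.<-trans m<r r<a)) (J-mono m r r<a m<r)))
    Jm≡j : J m ≡ j
    Jm≡j = subst (λ r → J r ≡ j) r≡m Jr≡j
    below′ : ∀ r′ → r′ ℕ.< suc m → J r′ ℕ.< suc j
    below′ r′ (s≤s r′≤m) with ℕP.m≤n⇒m<n∨m≡n r′≤m
    ... | inj₁ r′<m = ℕP.m<n⇒m<1+n (below r′ r′<m)
    ... | inj₂ refl = s≤s (ℕP.≤-reflexive Jm≡j)
    above′ : suc m ℕ.< a → suc j ≤ J (suc m)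
    above′ 1+m<a = subst (ℕ._< J (suc m)) Jm≡j (J-mono m (suc m) 1+m<a ℕP.≤-refl)

  countBefore-enumeration : ∀ r → r ℕ.< a → countBefore w c (J r) ≡ r
  countBefore-enumeration r r<a with invariant (J r) (ℕP.<⇒≤ (J-bound r r<a))
  ... | m , _ , count≡m , below , above = trans count≡m m≡r
    where
    m≡r : m ≡ r
    m≡r with ℕP.<-cmp m r
    ... | tri< m<r _ _ =
      ⊥-elim (ℕP.<-irrefl refl (ℕP.<-≤-trans (J-mono m r r<a m<r) (above (ℕP.<-trans m<r r<a))))
    ... | tri≈ _ m≡r _ = m≡r
    ... | tri> _ _ r<m = ⊥-elim (ℕP.<-irrefl refl (below r r<m))

  countW-enumeration : countW c w ≡ a
  countW-enumeration with invariant (length w) ℕP.≤-refl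
  ... | m , m≤a , count≡m , _ , above = trans (sym (countBefore-length w c)) (trans count≡m m≡a)
    where
    m≡a : m ≡ a
    m≡a with ℕP.m≤n⇒m<n∨m≡n m≤a
    ... | inj₁ m<a = ⊥-elim (ℕP.<-irrefl refl (ℕP.≤-<-trans (above m<a) (J-bound m m<a)))
    ... | inj₂ m≡a = m≡a

injective⇒surjective : ∀ {n} (σ : Fin n → Fin n) → Injective _≡_ _≡_ σ → ∀ j → ∃ λ p → σ p ≡ j
injective⇒surjective {suc n} σ σ-inj j with FP.any? (λ p → σ p F.≟ j)
... | yes hit = hit
... | no miss = ⊥-elim (ℕP.<-irrefl refl (FP.injective⇒≤ punchOut-j-injective))
  where
  σ≢j : ∀ p → j ≢ σ p
  σ≢j p j≡σp = miss (p , sym j≡σp)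
  punchOut-j : Fin (suc n) → Fin n
  punchOut-j p = F.punchOut (σ≢j p)
  punchOut-j-injective : Injective _≡_ _≡_ punchOut-j
  punchOut-j-injective {p} {q} e = σ-inj (FP.punchOut-injective (σ≢j p) (σ≢j q) e)

-- (A,S)-permutations

module ASPermutations {k : ℕ} (A : Fin k → ℕ) (S : Subset k) where

  private
    n = total A

  -- The rank of a letter among the copies of its colour: read from the left
  -- in increasing blocks and from the right in decreasing ones.
  orient : Fin k → ℕ → ℕ
  orient c r with c ∈? S
  ... | yes _ = A c ∸ suc r
  ... | no _ = r

  orient-< : ∀ c {r} → r ℕ.< A c → orient c r ℕ.< A c
  orient-< c {r} r<A with c ∈? S
  ... | no _ = r<A
  ... | yes _ = ℕP.∸-monoʳ-< (s≤s z≤n) r<A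

  orient-involutive : ∀ c {r} → r ℕ.< A c → orient c (orient c r) ≡ r
  orient-involutive c {r} r<A with c ∈? S
  ... | no _ = refl
  ... | yes _ = trans (cong (A c ∸_) (sym (ℕP.+-∸-assoc 1 r<A))) (ℕP.m∸[m∸n]≡n (ℕP.<⇒≤ r<A))

  orient-∉ : ∀ {c} r → c ∉ S → orient c r ≡ r
  orient-∉ {c} r c∉S with c ∈? S
  ... | yes c∈S = ⊥-elim (c∉S c∈S)
  ... | no _ = refl

  orient-∈ : ∀ {c r s} → c ∈ S → r ℕ.< s → s ℕ.< A c → orient c s ℕ.< orient c r
  orient-∈ {c} c∈S r<s s<A with c ∈? S
  ... | yes _ = ℕP.∸-monoʳ-< (s≤s r<s) s<A
  ... | no c∉S = ⊥-elim (c∉S c∈S)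

  orient-injective : ∀ c {r s} → r ℕ.< A c → s ℕ.< A c → orient c r ≡ orient c s → r ≡ s
  orient-injective c {r} {s} r<A s<A e =
    trans (sym (orient-involutive c r<A)) (trans (cong (orient c) e) (orient-involutive c s<A))

  block : Fin n → Fin k
  block p = proj₁ (block-exists A (toℕ p) (FP.toℕ<n p))

  block-InBlock : ∀ p → InBlock A (block p) p
  block-InBlock p = proj₂ (block-exists A (toℕ p) (FP.toℕ<n p))

  InBlock⇒block≡ : ∀ {c p} → InBlock A c p → block p ≡ c
  InBlock⇒block≡ {c} {p} (lo , hi) =
    block-unique A (block p) c (toℕ p) (proj₁ (block-InBlock p)) (proj₂ (block-InBlock p)) lo hi

  rank : Fin k → Fin n → ℕ
  rank c p = toℕ p ∸ start A c

  rank< : ∀ {c p} → InBlock A c p → rank c p ℕ.< A c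
  rank< {c} (lo , hi) = ℕP.+-cancelˡ-< (start A c) _ _ (subst (ℕ._< start A c + A c) (sym (ℕP.m+[n∸m]≡n lo)) hi)

  rank-injective : ∀ {c p q} → InBlock A c p → InBlock A c q → rank c p ≡ rank c q → p ≡ q
  rank-injective {c} {p} {q} (p≥ , _) (q≥ , _) e = FP.toℕ-injective
    (trans (sym (ℕP.m+[n∸m]≡n p≥)) (trans (cong (start A c +_) e) (ℕP.m+[n∸m]≡n q≥)))

  position : ∀ c r → .(r ℕ.< A c) → Fin n
  position c r r<A = F.fromℕ< (ℕP.<-≤-trans (ℕP.+-monoʳ-< (start A c) r<A) (start+size≤total A c))

  toℕ-position : ∀ c r .(r<A : r ℕ.< A c) → toℕ (position c r r<A) ≡ start A c + r
  toℕ-position c r r<A = FP.toℕ-fromℕ< _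

  position-InBlock : ∀ c {r} (r<A : r ℕ.< A c) → InBlock A c (position c r r<A)
  position-InBlock c {r} r<A =
    subst (start A c ≤_) (sym (toℕ-position c r r<A)) (ℕP.m≤m+n _ r) ,
    subst (ℕ._< start A c + A c) (sym (toℕ-position c r r<A)) (ℕP.+-monoʳ-< (start A c) r<A)

  rank-position : ∀ c r .(r<A : r ℕ.< A c) → rank c (position c r r<A) ≡ r
  rank-position c r r<A = trans (cong (_∸ start A c) (toℕ-position c r r<A)) (ℕP.m+n∸m≡n (start A c) r)

  position-< : ∀ c {r s} .(r<A : r ℕ.< A c) .(s<A : s ℕ.< A c) → r ℕ.< s → position c r r<A F.< position c s s<A
  position-< c {r} {s} r<A s<A r<s =
    subst₂ ℕ._<_ (sym (toℕ-position c r r<A)) (sym (toℕ-position c s s<A)) (ℕP.+-monoʳ-< (start A c) r<s)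

  module _ (w : Word k) (content : HasContent A w) where

    private
      <A⇒<countW : ∀ {c r} → r ℕ.< A c → r ℕ.< countW c w
      <A⇒<countW {c} {r} = subst (r ℕ.<_) (sym (content c))

      occurrence<n : ∀ c {r} → r ℕ.< A c → occurrence w c (orient c r) ℕ.< n
      occurrence<n c {r} r<A = subst (occurrence w c (orient c r) ℕ.<_) (length-content {w = w} content)
        (occurrence<length w c _ (<A⇒<countW (orient-< c r<A)))

    permutationOf : Fin n → Fin n
    permutationOf p = F.fromℕ< (occurrence<n (block p) (rank< (block-InBlock p)))

    toℕ-permutationOf : ∀ {c p} → InBlock A c p → toℕ (permutationOf p) ≡ occurrence w c (orient c (rank c p))
    toℕ-permutationOf {c} {p} p∈c = trans (FP.toℕ-fromℕ< _)
      (cong (λ d → occurrence w d (orient d (rank d p))) (InBlock⇒block≡ p∈c))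

    permutationOf-injective : Injective _≡_ _≡_ permutationOf
    permutationOf-injective {p} {q} σp≡σq = rank-injective p∈c q∈c
      (orient-injective c (rank< p∈c) (rank< q∈c)
        (occurrence-injective w c (<A⇒<countW (orient-< c (rank< p∈c))) (<A⇒<countW (orient-< c (rank< q∈c)))
          (trans (sym (toℕ-permutationOf p∈c)) (trans (cong toℕ σp≡σq) (toℕ-permutationOf q∈c)))))
      where
      c = block p
      p∈c = block-InBlock p
      q∈d = block-InBlock q
      c≡d : c ≡ block q
      c≡d = occurrence-colour w (<A⇒<countW (orient-< c (rank< p∈c)))
                                (<A⇒<countW (orient-< (block q) (rank< q∈d)))
              (trans (sym (toℕ-permutationOf p∈c)) (trans (cong toℕ σp≡σq) (toℕ-permutationOf q∈d)))
      q∈c : InBlock A c q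
      q∈c = subst (λ d → InBlock A d q) (sym c≡d) q∈d

    permutationOf-isASPerm : IsASPerm A S permutationOf
    permutationOf-isASPerm = permutationOf-injective , monotone
      where
      monotone : ∀ i p q → InBlock A i p → InBlock A i q → p F.< q →
                 (i ∈ S → permutationOf q F.< permutationOf p) × (i ∉ S → permutationOf p F.< permutationOf q)
      monotone i p q p∈i q∈i p<q = decreasing , increasing
        where
        rp<rq : rank i p ℕ.< rank i q
        rp<rq = ℕP.∸-monoˡ-< p<q (proj₁ p∈i)
        decreasing : i ∈ S → permutationOf q F.< permutationOf p
        decreasing i∈S = subst₂ ℕ._<_ (sym (toℕ-permutationOf q∈i)) (sym (toℕ-permutationOf p∈i))
          (occurrence-mono w i (orient-∈ i∈S rp<rq (rank< q∈i)) (<A⇒<countW (orient-< i (rank< p∈i))))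
        increasing : i ∉ S → permutationOf p F.< permutationOf q
        increasing i∉S = subst₂ ℕ._<_
          (trans (cong (occurrence w i) (sym (orient-∉ _ i∉S))) (sym (toℕ-permutationOf p∈i)))
          (trans (cong (occurrence w i) (sym (orient-∉ _ i∉S))) (sym (toℕ-permutationOf q∈i)))
          (occurrence-mono w i rp<rq (<A⇒<countW (rank< q∈i)))

  module _ (σ : Fin n → Fin n) (σ-inj : Injective _≡_ _≡_ σ) where

    σ⁻¹ : Fin n → Fin n
    σ⁻¹ j = proj₁ (injective⇒surjective σ σ-inj j)

    σ-σ⁻¹ : ∀ j → σ (σ⁻¹ j) ≡ j
    σ-σ⁻¹ j = proj₂ (injective⇒surjective σ σ-inj j)

    σ⁻¹-σ : ∀ p → σ⁻¹ (σ p) ≡ p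
    σ⁻¹-σ p = σ-inj (σ-σ⁻¹ (σ p))

    wordOf : Word k
    wordOf = L.tabulate (block ∘ σ⁻¹)

    wordOf-‼-σ : ∀ {c p} → InBlock A c p → wordOf ‼ toℕ (σ p) ≡ just c
    wordOf-‼-σ {c} {p} p∈c = trans (‼-tabulate (block ∘ σ⁻¹) (toℕ (σ p)) (FP.toℕ<n (σ p)))
      (cong just (trans (cong (block ∘ σ⁻¹) (FP.fromℕ<-toℕ (σ p) (FP.toℕ<n (σ p))))
                        (trans (cong block (σ⁻¹-σ p)) (InBlock⇒block≡ p∈c))))

  wordOf-cong : ∀ {σ τ} (σ-inj : Injective _≡_ _≡_ σ) (τ-inj : Injective _≡_ _≡_ τ) →
                (∀ p → σ p ≡ τ p) → wordOf σ σ-inj ≡ wordOf τ τ-inj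
  wordOf-cong {σ} {τ} σ-inj τ-inj σ≗τ = LP.tabulate-cong λ j → cong block
    (σ-inj (trans (σ-σ⁻¹ σ σ-inj j) (trans (sym (τ-σ⁻¹ j)) (sym (σ≗τ (σ⁻¹ τ τ-inj j))))))
    where
    τ-σ⁻¹ : ∀ j → τ (σ⁻¹ τ τ-inj j) ≡ j
    τ-σ⁻¹ = σ-σ⁻¹ τ τ-inj

  module _ (σ : Fin n → Fin n) (isASPerm : IsASPerm A S σ) where

    private
      σ-inj = proj₁ isASPerm
      w = wordOf σ σ-inj

    -- The positions of the copies of c in w, by oriented rank (0 is a junk value).
    enumeration : Fin k → ℕ → ℕ
    enumeration c r with r ℕ.<? A c
    ... | yes r<A = toℕ (σ (position c (orient c r) (orient-< c r<A)))
    ... | no _ = 0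

    enumeration-≡ : ∀ c {r} (r<A : r ℕ.< A c) →
                    enumeration c r ≡ toℕ (σ (position c (orient c r) (orient-< c r<A)))
    enumeration-≡ c {r} r<A with r ℕ.<? A c
    ... | yes _ = refl
    ... | no r≮A = ⊥-elim (r≮A r<A)

    enumeration-mono : ∀ c r s → s ℕ.< A c → r ℕ.< s → enumeration c r ℕ.< enumeration c s
    enumeration-mono c r s s<A r<s =
      subst₂ ℕ._<_ (sym (enumeration-≡ c r<A)) (sym (enumeration-≡ c s<A)) (by-orientation (c ∈? S))
      where
      r<A = ℕP.<-trans r<s s<A
      ρr<A = orient-< c r<A
      ρs<A = orient-< c s<A
      pᵣ = position c (orient c r) ρr<A
      pₛ = position c (orient c s) ρs<A
      by-orientation : Dec (c ∈ S) → σ pᵣ F.< σ pₛ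
      by-orientation (yes c∈S) =
        proj₁ (proj₂ isASPerm c pₛ pᵣ (position-InBlock c ρs<A) (position-InBlock c ρr<A)
                (position-< c ρs<A ρr<A (orient-∈ c∈S r<s s<A))) c∈S
      by-orientation (no c∉S) =
        proj₂ (proj₂ isASPerm c pᵣ pₛ (position-InBlock c ρr<A) (position-InBlock c ρs<A)
                (position-< c ρr<A ρs<A (subst₂ ℕ._<_ (sym (orient-∉ r c∉S)) (sym (orient-∉ s c∉S)) r<s))) c∉S

    enumeration-hit : ∀ c r → r ℕ.< A c → w ‼ enumeration c r ≡ just c
    enumeration-hit c r r<A =
      trans (cong (w ‼_) (enumeration-≡ c r<A)) (wordOf-‼-σ σ σ-inj (position-InBlock c (orient-< c r<A)))

    σ-orient-rank : ∀ {c p} (p∈c : InBlock A c p) → enumeration c (orient c (rank c p)) ≡ toℕ (σ p)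
    σ-orient-rank {c} {p} p∈c = trans (enumeration-≡ c (orient-< c (rank< p∈c)))
      (cong (toℕ ∘ σ) (FP.toℕ-injective (trans (toℕ-position c _ (orient-< c (orient-< c (rank< p∈c))))
        (trans (cong (start A c +_) (orient-involutive c (rank< p∈c))) (ℕP.m+[n∸m]≡n (proj₁ p∈c))))))

    enumeration-cover : ∀ c j → w ‼ j ≡ just c → ∃ λ r → r ℕ.< A c × enumeration c r ≡ j
    enumeration-cover c j w[j]≡c = orient c (rank c p) , orient-< c (rank< p∈c) ,
      trans (σ-orient-rank p∈c) (trans (cong toℕ (σ-σ⁻¹ σ σ-inj j′)) (FP.toℕ-fromℕ< j<n))
      where
      j<n : j ℕ.< n
      j<n = subst (j ℕ.<_) (LP.length-tabulate _) (‼-just⇒< w j w[j]≡c)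
      j′ = F.fromℕ< j<n
      p = σ⁻¹ σ σ-inj j′
      p∈c : InBlock A c p
      p∈c = subst (λ d → InBlock A d p) (MaybeP.just-injective (trans (sym (‼-tabulate _ j j<n)) w[j]≡c))
                  (block-InBlock p)

    module E (c : Fin k) =
      Enumeration w c (A c) (enumeration c) (enumeration-mono c) (enumeration-hit c) (enumeration-cover c)

    wordOf-content : HasContent A w
    wordOf-content c = E.countW-enumeration c

    permutationOf-wordOf : ∀ p → permutationOf w wordOf-content p ≡ σ p
    permutationOf-wordOf p = FP.toℕ-injective (begin
      toℕ (permutationOf w wordOf-content p)
        ≡⟨ toℕ-permutationOf w wordOf-content p∈c ⟩
      occurrence w c (orient c (rank c p))
        ≡⟨ cong (occurrence w c) (E.countBefore-enumeration c _ (orient-< c (rank< p∈c))) ⟨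
      occurrence w c (countBefore w c (enumeration c (orient c (rank c p))))
        ≡⟨ cong (occurrence w c ∘ countBefore w c) (σ-orient-rank p∈c) ⟩
      occurrence w c (countBefore w c (toℕ (σ p)))
        ≡⟨ occurrence-countBefore w c (toℕ (σ p)) (wordOf-‼-σ σ σ-inj p∈c) ⟩
      toℕ (σ p)
        ∎)
      where
      open P.≡-Reasoning
      c = block p
      p∈c = block-InBlock p

  wordOf-permutationOf : ∀ w content → wordOf (permutationOf w content) (permutationOf-injective w content) ≡ w
  wordOf-permutationOf w content = ‼-ext (wordOf σ σ-inj) w λ j → same-letter j (j ℕ.<? n)
    where
    σ = permutationOf w content
    σ-inj = permutationOf-injective w content
    |w|≡n : length w ≡ n
    |w|≡n = length-content {w = w} content
    same-letter : ∀ j → Dec (j ℕ.< n) → wordOf σ σ-inj ‼ j ≡ w ‼ j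
    same-letter j (no j≮n) = trans (‼-tabulate-≥ (block ∘ σ⁻¹ σ σ-inj) j (ℕP.≮⇒≥ j≮n))
      (sym (≥⇒‼-nothing w j (subst (_≤ j) (sym |w|≡n) (ℕP.≮⇒≥ j≮n))))
    same-letter j (yes j<n) = letter (<⇒‼-just w j (subst (j ℕ.<_) (sym |w|≡n) j<n))
      where
      letter : (∃ λ x → w ‼ j ≡ just x) → wordOf σ σ-inj ‼ j ≡ w ‼ j
      letter (x , w[j]≡x) =
        trans (cong (wordOf σ σ-inj ‼_) (sym σp≡j)) (trans (wordOf-‼-σ σ σ-inj p∈x) (sym w[j]≡x))
        where
        r = countBefore w x j
        r<A : r ℕ.< A x
        r<A = subst (r ℕ.<_) (content x) (countBefore<countW w x j w[j]≡x)
        ρr<A = orient-< x r<A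
        p = position x (orient x r) ρr<A
        p∈x = position-InBlock x ρr<A
        σp≡j : toℕ (σ p) ≡ j
        σp≡j = begin
          toℕ (σ p)                                ≡⟨ toℕ-permutationOf w content p∈x ⟩
          occurrence w x (orient x (rank x p))     ≡⟨ cong (occurrence w x ∘ orient x) (rank-position x _ ρr<A) ⟩
          occurrence w x (orient x (orient x r))   ≡⟨ cong (occurrence w x) (orient-involutive x r<A) ⟩
          occurrence w x r                         ≡⟨ occurrence-countBefore w x j w[j]≡x ⟩
          j                                        ∎
          where open P.≡-Reasoning

  permutationOf-cong : ∀ {w w′} content content′ → w ≡ w′ →
                       ∀ p → permutationOf w content p ≡ permutationOf w′ content′ p
  permutationOf-cong {w} content content′ refl p = FP.toℕ-injective
    (trans (toℕ-permutationOf w content (block-InBlock p)) (sym (toℕ-permutationOf w content′ (block-InBlock p))))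

  asPermutations↔words : Inverse (ASPermSetoid A S) (WordSetoid A)
  asPermutations↔words = mkInverse (ASPermSetoid A S) (WordSetoid A)
    (λ (σ , isASPerm) → wordOf σ (proj₁ isASPerm) , wordOf-content σ isASPerm)
    (λ (w , content) → permutationOf w content , permutationOf-isASPerm w content)
    (λ {(σ , σ-isASPerm)} {(τ , τ-isASPerm)} → wordOf-cong (proj₁ σ-isASPerm) (proj₁ τ-isASPerm))
    (λ {(_ , content)} {(_ , content′)} → permutationOf-cong content content′)
    (λ (w , content) → wordOf-permutationOf w content)
    (λ (σ , isASPerm) → permutationOf-wordOf σ isASPerm)

proposition2p4 : (k : ℕ) (A : Fin k → ℕ) → (∀ i → 1 ≤ A i) → (S : Subset k) →
    Bijection (ASPermSetoid A S) (GoodOrnamentSetoid A)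
proposition2p4 k A _ S =
  Inverse⇒Bijection (Composition.inverse (ASPermutations.asPermutations↔words A S) (words↔goodOrnaments A))
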